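{- For every integer $v\geq 4$ there are two graphs $G$ and $G'$ on the same set $V$ of $v$ vertices which are $k$-hypomorphic for all $k\in\{v-1,v\}$, but $G'\neq G$ and $G'\neq\overline G$.
   Context: A graph is a pair $G=(V,E)$ with $E$ a set of 2-element subsets of $V$; $\overline G$ is its complement and $G_{\restriction X}$ the induced subgraph on $X\subseteq V$. Two graphs $G,G'$ on the same vertex set $V$ are $k$-hypomorphic if $G_{\restriction X}$ and $G'_{\restriction X}$ are isomorphic for every $k$-element subset $X$ of $V$. -}

module Defs where

open import Data.Nat using (ℕ)
open import Data.Bool using (Bool; true; false; not)
open import Data.Fin using (Fin)
open import Data.Fin.Subset using (Subset; _∈_; ∣_∣)
open import Data.Product using (Σ; _×_; ∃; ∃-syntax)
open import Relation.Binary.PropositionalEquality using (_≡_; _≢_)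
open import Relation.Nullary using (¬_; does)
open import Data.Fin using (_≟_)
open import Data.Empty using (⊥-elim)

record Graph (v : ℕ) : Set where
  field
    adj   : Fin v → Fin v → Bool
    adj-sym : ∀ x y → adj x y ≡ adj y x
    adj-irrefl : ∀ x → adj x x ≡ false
open Graph public

SameGraph : ∀ {v} → Graph v → Graph v → Set
SameGraph G H = ∀ x y → adj G x y ≡ adj H x y

complement : ∀ {v} → Graph v → Graph v
complement {v} G = record { adj = a ; adj-sym = s ; adj-irrefl = i }
  where
  open import Relation.Nullary using (yes; no)
  open import Relation.Binary.PropositionalEquality using (refl; sym; cong)
  a : Fin v → Fin v → Bool
  a x y with x ≟ y
  ... | yes _ = false
  ... | no _  = not (adj G x y)
  s : ∀ x y → a x y ≡ a y x
  s x y with x ≟ y | y ≟ x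
  ... | yes _ | yes _ = refl
  ... | yes p | no q = ⊥-elim (q (sym p))
  ... | no p | yes q = ⊥-elim (p (sym q))
  ... | no _ | no _ = cong not (adj-sym G x y)
  i : ∀ x → a x x ≡ false
  i x with x ≟ x
  ... | yes _ = refl
  ... | no p = ⊥-elim (p refl)

InducedIso : ∀ {v} → Graph v → Graph v → Subset v → Set
InducedIso {v} G H X =
  Σ (Fin v → Fin v) λ f → Σ (Fin v → Fin v) λ g →
    (∀ x → x ∈ X → f x ∈ X) ×
    (∀ x → x ∈ X → g x ∈ X) ×
    (∀ x → x ∈ X → g (f x) ≡ x) ×
    (∀ x → x ∈ X → f (g x) ≡ x) ×
    (∀ x y → x ∈ X → y ∈ X → adj G x y ≡ adj H (f x) (f y))

Hypomorphic : ∀ {v} → ℕ → Graph v → Graph v → Set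
Hypomorphic {v} k G H = ∀ (X : Subset v) → ∣ X ∣ ≡ k → InducedIso G H X

-- G is the matching {01, 23} on the first four vertices (all others isolated)
-- and G' the matching {02, 13}.  The transpositions (1 2) and (0 3) both
-- conjugate the pairing (0 1)(2 3) into (0 2)(1 3), hence are isomorphisms
-- G ≅ G'.  A vertex set missing at most one vertex contains {1, 2} or {0, 3},
-- so one of the two transpositions maps it onto itself.  The edge 01 of G and
-- the non-edge 12 of G' separate G' from G and from the complement of G.
module Submission where

open import Defs
open import Algebra.Definitions using (Involutive)
open import Data.Bool using (Bool; _∧_; not)
open import Data.Bool.Properties using (∧-zeroʳ)
open import Data.Fin using (Fin; suc; _≟_)
open import Data.Fin.Patterns using (0F; 1F; 2F; 3F)
open import Data.Fin.Subset using (Subset; _∈_; _∉_; _∪_; ⁅_⁆; ∣_∣)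
open import Data.Fin.Subset.Properties
  using (_∈?_; ∣p∣≤n; p⊆p∪q; p⊂q⇒∣p∣<∣q∣; x∈p∪q⁺; x∈p∪q⁻; x∈⁅x⁆; x∈⁅y⁆⇒x≡y)
open import Data.Nat using (ℕ; suc; _≤_; _<_; _∸_; _+_; s≤s; z≤n)
open import Data.Nat.Properties using (≤-trans; ≤-reflexive; +-monoʳ-≤; 1+n≰n; m≤n+m∸n; m∸n≤m)
open import Data.Product using (Σ; _×_; _,_)
open import Data.Sum using (_⊎_; inj₁; inj₂; [_,_]; [_,_]′)
open import Function using (mk⇔)
open import Relation.Binary.PropositionalEquality
  using (_≡_; _≢_; refl; sym; trans; cong; cong₂; module ≡-Reasoning)
open import Relation.Nullary using (¬_; yes; no; does; contradiction)
open import Relation.Nullary.Decidable using (does-⇔; dec-true)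

private
  variable
    A : Set
    n : ℕ

involutive⇒injective : {f : A → A} → Involutive _≡_ f →
                       ∀ {x y} → f x ≡ f y → x ≡ y
involutive⇒injective {f = f} inv {x} {y} fx≡fy = begin
  x         ≡⟨ sym (inv x) ⟩
  f (f x)   ≡⟨ cong f fx≡fy ⟩
  f (f y)   ≡⟨ inv y ⟩
  y         ∎
  where open ≡-Reasoning

involution⇒InducedIso : ∀ {G H : Graph n} {X : Subset n} (f : Fin n → Fin n) →
  Involutive _≡_ f → (∀ {x} → x ∈ X → f x ∈ X) →
  (∀ x y → adj G x y ≡ adj H (f x) (f y)) → InducedIso G H X
involution⇒InducedIso f inv closed iso =
  f , f , (λ _ → closed) , (λ _ → closed) , (λ x _ → inv x) , (λ x _ → inv x) ,
  (λ x y _ _ → iso x y)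

x∉p⇒∣p∣<∣p∪⁅x⁆∣ : {x : Fin n} (p : Subset n) → x ∉ p → 1 + ∣ p ∣ ≤ ∣ p ∪ ⁅ x ⁆ ∣
x∉p⇒∣p∣<∣p∪⁅x⁆∣ {x = x} p x∉p =
  p⊂q⇒∣p∣<∣q∣ (p⊆p∪q ⁅ x ⁆ , x , x∈p∪q⁺ (inj₂ (x∈⁅x⁆ x)) , x∉p)

x≢y⇒x∉p⇒y∉p⇒2+∣p∣≤n : {x y : Fin n} (p : Subset n) → x ≢ y → x ∉ p → y ∉ p →
                      2 + ∣ p ∣ ≤ n
x≢y⇒x∉p⇒y∉p⇒2+∣p∣≤n {x = x} {y} p x≢y x∉p y∉p =
  ≤-trans (s≤s (x∉p⇒∣p∣<∣p∪⁅x⁆∣ p x∉p))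
    (≤-trans (x∉p⇒∣p∣<∣p∪⁅x⁆∣ (p ∪ ⁅ x ⁆) y∉p∪⁅x⁆) (∣p∣≤n ((p ∪ ⁅ x ⁆) ∪ ⁅ y ⁆)))
  where
  y∉p∪⁅x⁆ : y ∉ p ∪ ⁅ x ⁆
  y∉p∪⁅x⁆ y∈ = [ y∉p , (λ y∈⁅x⁆ → x≢y (sym (x∈⁅y⁆⇒x≡y x y∈⁅x⁆))) ] (x∈p∪q⁻ p ⁅ x ⁆ y∈)

n∸1≤∣p∣⇒x∉p⇒x≢y⇒y∈p : {x : Fin n} (p : Subset n) → n ∸ 1 ≤ ∣ p ∣ →
                      x ∉ p → ∀ {y} → x ≢ y → y ∈ p
n∸1≤∣p∣⇒x∉p⇒x≢y⇒y∈p {n = n} p large x∉p {y} x≢y with y ∈? p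
... | yes y∈p = y∈p
... | no  y∉p = contradiction
  (≤-trans (+-monoʳ-≤ 2 large)
    (≤-trans (x≢y⇒x∉p⇒y∉p⇒2+∣p∣≤n p x≢y x∉p y∉p) (m≤n+m∸n n 1)))
  1+n≰n

matchingAdj : (Fin n → Fin n) → Fin n → Fin n → Bool
matchingAdj p x y = does (p x ≟ y) ∧ not (does (x ≟ y))

matching : (p : Fin n → Fin n) → Involutive _≡_ p → Graph n
matching p inv = record
  { adj        = matchingAdj p
  ; adj-sym    = λ x y → cong₂ (λ a b → a ∧ not b)
                   (does-⇔ (mk⇔ (paired x y) (paired y x)) (p x ≟ y) (p y ≟ x))
                   (does-⇔ (mk⇔ sym sym) (x ≟ y) (y ≟ x))
  ; adj-irrefl = λ x → trans (cong (λ b → does (p x ≟ x) ∧ not b) (dec-true (x ≟ x) refl))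
                             (∧-zeroʳ _)
  }
  where
  paired : ∀ x y → p x ≡ y → p y ≡ x
  paired x y px≡y = trans (sym (cong p px≡y)) (inv x)

matchingAdj-conjugate : {p q f : Fin n → Fin n} → (∀ {x y} → f x ≡ f y → x ≡ y) →
  (∀ x → f (p x) ≡ q (f x)) → ∀ x y → matchingAdj p x y ≡ matchingAdj q (f x) (f y)
matchingAdj-conjugate {p = p} {q} {f} f-injective conj x y = cong₂ (λ a b → a ∧ not b)
  (does-⇔ (mk⇔ (λ px≡y → trans (sym (conj x)) (cong f px≡y))
               (λ qfx≡fy → f-injective (trans (conj x) qfx≡fy)))
          (p x ≟ y) (q (f x) ≟ f y))
  (does-⇔ (mk⇔ (cong f) f-injective) (x ≟ y) (f x ≟ f y))

conjugator⇒InducedIso : {p q : Fin n → Fin n} {X : Subset n} (p-inv : Involutive _≡_ p)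
  (q-inv : Involutive _≡_ q) (f : Fin n → Fin n) → Involutive _≡_ f →
  (∀ x → f (p x) ≡ q (f x)) → (∀ {x} → x ∈ X → f x ∈ X) →
  InducedIso (matching p p-inv) (matching q q-inv) X
conjugator⇒InducedIso {p = p} {q} p-inv q-inv f f-inv conj closed =
  involution⇒InducedIso {G = matching p p-inv} {H = matching q q-inv} f f-inv closed
    (matchingAdj-conjugate {p = p} {q} (involutive⇒injective f-inv) conj)

pattern 4+ k = suc (suc (suc (suc k)))

fourCases : {P : Fin (4 + n) → Set} → P 0F → P 1F → P 2F → P 3F →
            (∀ k → P (4+ k)) → ∀ x → P x
fourCases p₀ p₁ p₂ p₃ p₄ 0F     = p₀
fourCases p₀ p₁ p₂ p₃ p₄ 1F     = p₁
fourCases p₀ p₁ p₂ p₃ p₄ 2F     = p₂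
fourCases p₀ p₁ p₂ p₃ p₄ 3F     = p₃
fourCases p₀ p₁ p₂ p₃ p₄ (4+ k) = p₄ k

pairing pairing′ swap₁₂ swap₀₃ : Fin (4 + n) → Fin (4 + n)
pairing 0F = 1F
pairing 1F = 0F
pairing 2F = 3F
pairing 3F = 2F
pairing (4+ k) = 4+ k

pairing′ 0F = 2F
pairing′ 1F = 3F
pairing′ 2F = 0F
pairing′ 3F = 1F
pairing′ (4+ k) = 4+ k

swap₁₂ 0F = 0F
swap₁₂ 1F = 2F
swap₁₂ 2F = 1F
swap₁₂ 3F = 3F
swap₁₂ (4+ k) = 4+ k

swap₀₃ 0F = 3F
swap₀₃ 1F = 1F
swap₀₃ 2F = 2F
swap₀₃ 3F = 0F
swap₀₃ (4+ k) = 4+ k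

pairing-involutive : Involutive _≡_ (pairing {n})
pairing-involutive = fourCases refl refl refl refl (λ _ → refl)

pairing′-involutive : Involutive _≡_ (pairing′ {n})
pairing′-involutive = fourCases refl refl refl refl (λ _ → refl)

swap₁₂-involutive : Involutive _≡_ (swap₁₂ {n})
swap₁₂-involutive = fourCases refl refl refl refl (λ _ → refl)

swap₀₃-involutive : Involutive _≡_ (swap₀₃ {n})
swap₀₃-involutive = fourCases refl refl refl refl (λ _ → refl)

swap₁₂-conjugates : ∀ x → swap₁₂ {n} (pairing x) ≡ pairing′ (swap₁₂ x)
swap₁₂-conjugates = fourCases refl refl refl refl (λ _ → refl)

swap₀₃-conjugates : ∀ x → swap₀₃ {n} (pairing x) ≡ pairing′ (swap₀₃ x)
swap₀₃-conjugates = fourCases refl refl refl refl (λ _ → refl)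

swap₁₂-closed : {X : Subset (4 + n)} → 1F ∈ X → 2F ∈ X → ∀ {x} → x ∈ X → swap₁₂ x ∈ X
swap₁₂-closed {X = X} 1∈X 2∈X {x} = fourCases {P = λ x → x ∈ X → swap₁₂ x ∈ X}
  (λ x∈X → x∈X) (λ _ → 2∈X) (λ _ → 1∈X) (λ x∈X → x∈X) (λ _ x∈X → x∈X) x

swap₀₃-closed : {X : Subset (4 + n)} → 0F ∈ X → 3F ∈ X → ∀ {x} → x ∈ X → swap₀₃ x ∈ X
swap₀₃-closed {X = X} 0∈X 3∈X {x} = fourCases {P = λ x → x ∈ X → swap₀₃ x ∈ X}
  (λ _ → 3∈X) (λ x∈X → x∈X) (λ x∈X → x∈X) (λ _ → 0∈X) (λ _ x∈X → x∈X) x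

G G′ : Graph (4 + n)
G  = matching pairing  pairing-involutive
G′ = matching pairing′ pairing′-involutive

nearlyFull⇒has₁₂⊎has₀₃ : (X : Subset (4 + n)) → 4 + n ∸ 1 ≤ ∣ X ∣ →
                         (1F ∈ X × 2F ∈ X) ⊎ (0F ∈ X × 3F ∈ X)
nearlyFull⇒has₁₂⊎has₀₃ X large with 1F ∈? X | 2F ∈? X
... | yes 1∈X | yes 2∈X = inj₁ (1∈X , 2∈X)
... | no 1∉X  | _       = inj₂ (others 1∉X (λ ()) , others 1∉X (λ ()))
  where others = n∸1≤∣p∣⇒x∉p⇒x≢y⇒y∈p X large
... | yes _   | no 2∉X  = inj₂ (others 2∉X (λ ()) , others 2∉X (λ ()))
  where others = n∸1≤∣p∣⇒x∉p⇒x≢y⇒y∈p X large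

nearlyFull⇒InducedIso : (X : Subset (4 + n)) → 4 + n ∸ 1 ≤ ∣ X ∣ → InducedIso G G′ X
nearlyFull⇒InducedIso {n = n} X large =
  [ (λ (1∈X , 2∈X) → via swap₁₂ swap₁₂-involutive swap₁₂-conjugates (swap₁₂-closed 1∈X 2∈X))
  , (λ (0∈X , 3∈X) → via swap₀₃ swap₀₃-involutive swap₀₃-conjugates (swap₀₃-closed 0∈X 3∈X))
  ]′ (nearlyFull⇒has₁₂⊎has₀₃ X large)
  where
  via : (f : Fin (4 + n) → Fin (4 + n)) → Involutive _≡_ f →
        (∀ x → f (pairing x) ≡ pairing′ (f x)) → (∀ {x} → x ∈ X → f x ∈ X) →
        InducedIso G G′ X
  via = conjugator⇒InducedIso {p = pairing} {q = pairing′} pairing-involutive pairing′-involutive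

lemma4p3 : ∀ (v : ℕ) → 4 ≤ v →
    Σ (Graph v) λ G → Σ (Graph v) λ G' →
      Hypomorphic (v ∸ 1) G G' × Hypomorphic v G G' ×
      ¬ SameGraph G' G × ¬ SameGraph G' (complement G)
lemma4p3 (4+ n) (s≤s (s≤s (s≤s (s≤s z≤n)))) =
  G , G′ ,
  (λ X ∣X∣≡v∸1 → nearlyFull⇒InducedIso X (≤-reflexive (sym ∣X∣≡v∸1))) ,
  (λ X ∣X∣≡v → nearlyFull⇒InducedIso X (≤-trans (m∸n≤m (4 + n) 1) (≤-reflexive (sym ∣X∣≡v)))) ,
  (λ same → contradiction (same 0F 1F) λ ()) ,
  (λ same → contradiction (same 1F 2F) λ ())
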